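{- Let $B\ge 3$ be odd. If $a+bi$ ($a,b\in\mathbb{Z}$) is a Gaussian $B$-happy number, then $a+b\equiv 1\pmod 2$.
   Context: Fix an integer $B\ge 2$. Every nonzero Gaussian integer $a+bi$ is written uniquely as $a+bi=\sum_{j=0}^n (a_j+b_ji)B^j$ with $a_j,b_j\in\mathbb{Z}$, $a_n,b_n$ not both $0$, and for each $j$: $|a_j|\le B-1$, $|b_j|\le B-1$, $\operatorname{sgn}(a)a_j\ge 0$, $\operatorname{sgn}(b)b_j\ge 0$. The Gaussian $B$-happy function $S_B:\mathbb{Z}[i]\to\mathbb{Z}[i]$ is defined by $S_B(0)=0$ and $S_B(a+bi)=\sum_{j=0}^n (a_j+b_ji)^2$. A Gaussian integer $z$ is Gaussian $B$-happy if $S_B^k(z)=1$ for some $k\ge1$. -}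

module Defs where

open import Data.Nat as ℕ using (ℕ; zero; suc; _/_; _%_)
open import Data.Integer as ℤ using (ℤ; +_; -[1+_]; _+_; _-_; _*_; -_)
open import Data.List using (List; []; _∷_; map)
open import Data.Product using (_×_; _,_)

ℤ[i] : Set
ℤ[i] = ℤ × ℤ

-- Base-B digits of a natural number, least significant first; no leading
-- zeros (digits of 0 is the empty list).  Fuel argument guarantees
-- termination; fuel = n suffices since n / B < n for n ≥ 1, B ≥ 2.
digitsFuel : (B : ℕ) → ℕ → ℕ → List ℕ
digitsFuel zero    _        _       = []
digitsFuel (suc b) zero     _       = []
digitsFuel (suc b) (suc f)  zero    = []
digitsFuel (suc b) (suc f)  (suc n) =
  (suc n % suc b) ∷ digitsFuel (suc b) f (suc n / suc b)

digits : (B : ℕ) → ℕ → List ℕ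
digits B n = digitsFuel B n n

-- Signed base-B digits of an integer a: the a_j with |a_j| ≤ B-1 and
-- sgn(a) a_j ≥ 0, i.e. sgn(a) times the digits of |a|.
signedDigits : (B : ℕ) → ℤ → List ℤ
signedDigits B (+ n)     = map +_ (digits B n)
signedDigits B -[1+ n ]  = map (λ d → - (+ d)) (digits B (suc n))

-- Pair up the digit sequences of the real and imaginary parts, padding the
-- shorter one with zeros (the common length is n+1 in the paper's notation).
zipPad : List ℤ → List ℤ → List (ℤ × ℤ)
zipPad []       []       = []
zipPad []       (y ∷ ys) = (+ 0 , y) ∷ zipPad [] ys
zipPad (x ∷ xs) []       = (x , + 0) ∷ zipPad xs []
zipPad (x ∷ xs) (y ∷ ys) = (x , y) ∷ zipPad xs ys

_+ᵍ_ : ℤ[i] → ℤ[i] → ℤ[i]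
(a , b) +ᵍ (c , d) = (a + c , b + d)

sqᵍ : ℤ[i] → ℤ[i]
sqᵍ (a , b) = (a * a - b * b , + 2 * (a * b))

sumᵍ : List ℤ[i] → ℤ[i]
sumᵍ []       = (+ 0 , + 0)
sumᵍ (z ∷ zs) = z +ᵍ sumᵍ zs

S : (B : ℕ) → ℤ[i] → ℤ[i]
S B (a , b) = sumᵍ (map sqᵍ (zipPad (signedDigits B a) (signedDigits B b)))

iter : {A : Set} → (A → A) → ℕ → A → A
iter f zero    x = x
iter f (suc k) x = f (iter f k x)

GaussianHappy : (B : ℕ) → ℤ[i] → Set
GaussianHappy B z = Data.Product.∃ λ k → (1 ℕ.≤ k) Data.Product.× (iter (S B) k z ≡ (+ 1 , + 0))
  where open import Relation.Binary.PropositionalEquality using (_≡_)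

{-# OPTIONS --safe #-}
-- For odd B, S_B preserves Re + Im modulo 2: as B ≡ 1 (mod 2), an integer is congruent to its
-- signed digit sum, and (x + yi)² = (x² − y²) + 2xy i has Re + Im ≡ x − y ≡ x + y since x² ≡ x.
module Submission where

open import Defs
open import Function using (_∘_)
open import Data.Nat as ℕ using (ℕ; zero; suc; s≤s; z≤n; _≤_; _<_; _%_; _/_)
import Data.Nat.Properties as ℕ
open import Data.Nat.DivMod using (m≡m%n+[m/n]*n; m/n<m; [m+kn]%n≡m%n)
open import Data.Nat.ListAction using (sum)
open import Data.Integer using (ℤ; +_; -[1+_]; _+_; _-_; _*_; -_; ∣_∣)
open import Data.Integer.Properties using (pos-+; pos-*; *-identityʳ; neg-distrib-+; ∣-i∣≡∣i∣)
open import Data.Integer.DivMod using (_%ℕ_; _/ℕ_; a≡a%ℕn+[a/ℕn]*n; n%ℕd<d)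
open import Data.Integer.Divisibility.Signed
  using (_∣_; divides; ∣m∣n⇒∣m+n; ∣m∣n⇒∣m-n; ∣m⇒∣-m; ∣n⇒∣m*n)
import Data.Integer.Tactic.RingSolver as ℤ-Ring
open import Data.List using (List; []; _∷_; map; foldr)
open import Data.List.Properties using (map-∘)
open import Data.Product using (_,_)
open import Relation.Binary.Bundles using (Setoid)
open import Relation.Binary.Structures using (IsEquivalence)
open import Relation.Binary.PropositionalEquality
  using (_≡_; refl; sym; trans; cong; subst; module ≡-Reasoning)

infix 4 _≡_[mod_]

record _≡_[mod_] (x y m : ℤ) : Set where
  constructor divides-difference
  field m∣x-y : m ∣ x - y

module _ {m : ℤ} where

  ≡⇒≡-mod : ∀ {x y} → x ≡ y → x ≡ y [mod m ]
  ≡⇒≡-mod {x} refl = divides-difference (divides (+ 0) (x-x≡0 x))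
    where x-x≡0 : ∀ x → x - x ≡ + 0 * m
          x-x≡0 = ℤ-Ring.solve-∀

  mod-sym : ∀ {x y} → x ≡ y [mod m ] → y ≡ x [mod m ]
  mod-sym {x} {y} (divides-difference x≡y) =
    divides-difference (subst (m ∣_) (-[x-y]≡y-x x y) (∣m⇒∣-m x≡y))
    where -[x-y]≡y-x : ∀ x y → - (x - y) ≡ y - x
          -[x-y]≡y-x = ℤ-Ring.solve-∀

  mod-trans : ∀ {x y z} → x ≡ y [mod m ] → y ≡ z [mod m ] → x ≡ z [mod m ]
  mod-trans {x} {y} {z} (divides-difference x≡y) (divides-difference y≡z) =
    divides-difference (subst (m ∣_) (telescope x y z) (∣m∣n⇒∣m+n x≡y y≡z))
    where telescope : ∀ x y z → (x - y) + (y - z) ≡ x - z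
          telescope = ℤ-Ring.solve-∀

  mod-isEquivalence : IsEquivalence _≡_[mod m ]
  mod-isEquivalence = record
    { refl  = ≡⇒≡-mod refl
    ; sym   = mod-sym
    ; trans = mod-trans
    }

  mod-+ : ∀ {x y u v} → x ≡ y [mod m ] → u ≡ v [mod m ] → x + u ≡ y + v [mod m ]
  mod-+ {x} {y} {u} {v} (divides-difference x≡y) (divides-difference u≡v) =
    divides-difference (subst (m ∣_) (interchange x y u v) (∣m∣n⇒∣m+n x≡y u≡v))
    where interchange : ∀ x y u v → (x - y) + (u - v) ≡ (x + u) - (y + v)
          interchange = ℤ-Ring.solve-∀

  mod-+ˡ : ∀ k {x y} → x ≡ y [mod m ] → k + x ≡ k + y [mod m ]
  mod-+ˡ k = mod-+ (≡⇒≡-mod {k} refl)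

  mod-neg : ∀ {x y} → x ≡ y [mod m ] → - x ≡ - y [mod m ]
  mod-neg {x} {y} (divides-difference x≡y) =
    divides-difference (subst (m ∣_) (neg-sub x y) (∣m⇒∣-m x≡y))
    where neg-sub : ∀ x y → - (x - y) ≡ - x - - y
          neg-sub = ℤ-Ring.solve-∀

  mod-*ˡ : ∀ k {x y} → x ≡ y [mod m ] → k * x ≡ k * y [mod m ]
  mod-*ˡ k {x} {y} (divides-difference x≡y) =
    divides-difference (subst (m ∣_) (*-distrib-sub k x y) (∣n⇒∣m*n k x≡y))
    where *-distrib-sub : ∀ k x y → k * (x - y) ≡ k * x - k * y
          *-distrib-sub = ℤ-Ring.solve-∀

mod-setoid : ℤ → Setoid _ _
mod-setoid m = record { isEquivalence = mod-isEquivalence {m} }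

sumℤ : List ℤ → ℤ
sumℤ = foldr _+_ (+ 0)

sumℤ-map-pos : ∀ ns → sumℤ (map +_ ns) ≡ + sum ns
sumℤ-map-pos []       = refl
sumℤ-map-pos (n ∷ ns) = trans (cong (_+_ (+ n)) (sumℤ-map-pos ns)) (sym (pos-+ n (sum ns)))

sumℤ-map-neg : ∀ ns → sumℤ (map (λ d → - (+ d)) ns) ≡ - (+ sum ns)
sumℤ-map-neg []       = refl
sumℤ-map-neg (n ∷ ns) = begin
  - (+ n) + sumℤ (map (λ d → - (+ d)) ns) ≡⟨ cong (_+_ (- (+ n))) (sumℤ-map-neg ns) ⟩
  - (+ n) + - (+ sum ns)                  ≡⟨ sym (neg-distrib-+ (+ n) (+ sum ns)) ⟩
  - (+ n + + sum ns)                      ≡⟨ cong -_ (sym (pos-+ n (sum ns))) ⟩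
  - (+ (n ℕ.+ sum ns))                    ∎
  where open ≡-Reasoning

sumℤ-map-cong-mod : ∀ {A : Set} {m} {f g : A → ℤ} → (∀ x → f x ≡ g x [mod m ]) →
               ∀ xs → sumℤ (map f xs) ≡ sumℤ (map g xs) [mod m ]
sumℤ-map-cong-mod f≡g []       = ≡⇒≡-mod refl
sumℤ-map-cong-mod f≡g (x ∷ xs) = mod-+ (f≡g x) (sumℤ-map-cong-mod f≡g xs)

digitSum-mod : ∀ {m} B → 2 ≤ B → + B ≡ + 1 [mod m ] → ∀ n → + sum (digits B n) ≡ + n [mod m ]
digitSum-mod {m} B@(suc (suc _)) (s≤s (s≤s z≤n)) B≡1 n = go n n ℕ.≤-refl
  where
  open import Relation.Binary.Reasoning.Setoid (mod-setoid m)

  go : ∀ f n → n ≤ f → + sum (digitsFuel B f n) ≡ + n [mod m ]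
  go zero    zero    _ = ≡⇒≡-mod refl
  go (suc f) zero    _ = ≡⇒≡-mod refl
  go (suc f) (suc n) n≤f = begin
    + (r ℕ.+ sum (digitsFuel B f q)) ≡⟨ pos-+ r _ ⟩
    + r + + sum (digitsFuel B f q)   ≈⟨ mod-+ˡ (+ r) (go f q q≤f) ⟩
    + r + + q                        ≡⟨ cong (_+_ (+ r)) (sym (*-identityʳ (+ q))) ⟩
    + r + + q * + 1                  ≈⟨ mod-+ˡ (+ r) (mod-*ˡ (+ q) (mod-sym B≡1)) ⟩
    + r + + q * + B                  ≡⟨ cong (_+_ (+ r)) (sym (pos-* q B)) ⟩
    + r + + (q ℕ.* B)                ≡⟨ sym (pos-+ r (q ℕ.* B)) ⟩
    + (r ℕ.+ q ℕ.* B)                ≡⟨ cong +_ (sym (m≡m%n+[m/n]*n (suc n) B)) ⟩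
    + suc n                          ∎
    where
    q = suc n / B
    r = suc n % B
    q≤f : q ≤ f
    q≤f = ℕ.≤-pred (ℕ.≤-trans (m/n<m (suc n) B (s≤s (s≤s z≤n))) n≤f)

signedDigitSum-mod : ∀ {m} B → 2 ≤ B → + B ≡ + 1 [mod m ] → ∀ a → sumℤ (signedDigits B a) ≡ a [mod m ]
signedDigitSum-mod {m} B 2≤B B≡1 (+ n) =
  subst (_≡ + n [mod m ]) (sym (sumℤ-map-pos (digits B n))) (digitSum-mod B 2≤B B≡1 n)
signedDigitSum-mod {m} B 2≤B B≡1 -[1+ n ] =
  subst (_≡ -[1+ n ] [mod m ]) (sym (sumℤ-map-neg (digits B (suc n))))
        (mod-neg (digitSum-mod B 2≤B B≡1 (suc n)))

reIm : ℤ[i] → ℤ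
reIm (a , b) = a + b

reIm-+ᵍ : ∀ z w → reIm (z +ᵍ w) ≡ reIm z + reIm w
reIm-+ᵍ (a , b) (c , d) = interchange a b c d
  where interchange : ∀ a b c d → (a + c) + (b + d) ≡ (a + b) + (c + d)
        interchange = ℤ-Ring.solve-∀

reIm-sumᵍ : ∀ zs → reIm (sumᵍ zs) ≡ sumℤ (map reIm zs)
reIm-sumᵍ []       = refl
reIm-sumᵍ (z ∷ zs) = trans (reIm-+ᵍ z (sumᵍ zs)) (cong (_+_ (reIm z)) (reIm-sumᵍ zs))

sumℤ-map-reIm-zipPad : ∀ xs ys → sumℤ (map reIm (zipPad xs ys)) ≡ sumℤ xs + sumℤ ys
sumℤ-map-reIm-zipPad []       []       = refl
sumℤ-map-reIm-zipPad []       (y ∷ ys) =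
  trans (cong (_+_ (+ 0 + y)) (sumℤ-map-reIm-zipPad [] ys)) (shuffle y (sumℤ ys))
  where shuffle : ∀ y s → (+ 0 + y) + (+ 0 + s) ≡ + 0 + (y + s)
        shuffle = ℤ-Ring.solve-∀
sumℤ-map-reIm-zipPad (x ∷ xs) []       =
  trans (cong (_+_ (x + + 0)) (sumℤ-map-reIm-zipPad xs [])) (shuffle x (sumℤ xs))
  where shuffle : ∀ x s → (x + + 0) + (s + + 0) ≡ (x + s) + + 0
        shuffle = ℤ-Ring.solve-∀
sumℤ-map-reIm-zipPad (x ∷ xs) (y ∷ ys) =
  trans (cong (_+_ (x + y)) (sumℤ-map-reIm-zipPad xs ys)) (interchange x y (sumℤ xs) (sumℤ ys))
  where interchange : ∀ x y s t → (x + y) + (s + t) ≡ (x + s) + (y + t)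
        interchange = ℤ-Ring.solve-∀

sq≡self-mod-2 : ∀ x → x * x ≡ x [mod + 2 ]
sq≡self-mod-2 x =
  subst (λ y → y * y ≡ y [mod + 2 ]) (sym (a≡a%ℕn+[a/ℕn]*n x 2))
        (by-remainder (x %ℕ 2) (n%ℕd<d x 2))
  where
  q = x /ℕ 2
  by-remainder : ∀ r → r < 2 → (+ r + q * + 2) * (+ r + q * + 2) ≡ + r + q * + 2 [mod + 2 ]
  by-remainder 0 _ = divides-difference (divides (q * q * + 2 - q) (even q))
    where even : ∀ q → (+ 0 + q * + 2) * (+ 0 + q * + 2) - (+ 0 + q * + 2) ≡ (q * q * + 2 - q) * + 2
          even = ℤ-Ring.solve-∀
  by-remainder 1 _ = divides-difference (divides (q * q * + 2 + q) (odd q))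
    where odd : ∀ q → (+ 1 + q * + 2) * (+ 1 + q * + 2) - (+ 1 + q * + 2) ≡ (q * q * + 2 + q) * + 2
          odd = ℤ-Ring.solve-∀
  by-remainder (suc (suc _)) (s≤s (s≤s ()))

reIm-sqᵍ : ∀ z → reIm (sqᵍ z) ≡ reIm z [mod + 2 ]
reIm-sqᵍ (x , y) with sq≡self-mod-2 x | sq≡self-mod-2 y
... | divides-difference 2∣x²-x | divides-difference 2∣y²-y = divides-difference
  (subst (+ 2 ∣_) (regroup x y) (∣m∣n⇒∣m+n (∣m∣n⇒∣m-n 2∣x²-x 2∣y²-y) (divides (x * y - y) refl)))
  where regroup : ∀ x y → (x * x - x) - (y * y - y) + (x * y - y) * + 2
                        ≡ (x * x - y * y + + 2 * (x * y)) - (x + y)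
        regroup = ℤ-Ring.solve-∀

reIm-S-mod-2 : ∀ B → 2 ≤ B → + B ≡ + 1 [mod + 2 ] → ∀ z → reIm (S B z) ≡ reIm z [mod + 2 ]
reIm-S-mod-2 B 2≤B B≡1 (a , b) = begin
  reIm (sumᵍ (map sqᵍ ps))        ≡⟨ reIm-sumᵍ (map sqᵍ ps) ⟩
  sumℤ (map reIm (map sqᵍ ps))    ≡⟨ cong sumℤ (sym (map-∘ ps)) ⟩
  sumℤ (map (reIm ∘ sqᵍ) ps)      ≈⟨ sumℤ-map-cong-mod reIm-sqᵍ ps ⟩
  sumℤ (map reIm ps)              ≡⟨ sumℤ-map-reIm-zipPad da db ⟩
  sumℤ da + sumℤ db               ≈⟨ mod-+ (digits≡ a) (digits≡ b) ⟩
  a + b                           ∎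
  where
  da = signedDigits B a
  db = signedDigits B b
  ps = zipPad da db
  digits≡ : ∀ x → sumℤ (signedDigits B x) ≡ x [mod + 2 ]
  digits≡ = signedDigitSum-mod B 2≤B B≡1
  open import Relation.Binary.Reasoning.Setoid (mod-setoid (+ 2))

iter-invariant-mod : ∀ {A : Set} {m} (f : A → A) (h : A → ℤ) → (∀ z → h (f z) ≡ h z [mod m ]) →
                     ∀ k z → h (iter f k z) ≡ h z [mod m ]
iter-invariant-mod f h inv zero    z = ≡⇒≡-mod refl
iter-invariant-mod f h inv (suc k) z = mod-trans (inv (iter f k z)) (iter-invariant-mod f h inv k z)

odd⇒≡1-mod-2 : ∀ B → B % 2 ≡ 1 → + B ≡ + 1 [mod + 2 ]
odd⇒≡1-mod-2 B B%2≡1 = divides-difference (divides q (begin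
  + B - + 1                  ≡⟨ cong (_- + 1) (a≡a%ℕn+[a/ℕn]*n (+ B) 2) ⟩
  + (B % 2) + q * + 2 - + 1  ≡⟨ cong (λ r → + r + q * + 2 - + 1) B%2≡1 ⟩
  + 1 + q * + 2 - + 1        ≡⟨ cancel q ⟩
  q * + 2                    ∎))
  where
  open ≡-Reasoning
  q = + B /ℕ 2
  cancel : ∀ q → + 1 + q * + 2 - + 1 ≡ q * + 2
  cancel = ℤ-Ring.solve-∀

∣1+k*2∣%2≡1 : ∀ k → ∣ + 1 + k * + 2 ∣ % 2 ≡ 1
∣1+k*2∣%2≡1 (+ j) = begin
  ∣ + 1 + + j * + 2 ∣ % 2  ≡⟨ cong (λ t → ∣ + 1 + t ∣ % 2) (sym (pos-* j 2)) ⟩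
  (1 ℕ.+ j ℕ.* 2) % 2      ≡⟨ [m+kn]%n≡m%n 1 j 2 ⟩
  1                        ∎
  where open ≡-Reasoning
∣1+k*2∣%2≡1 -[1+ j ] = begin
  ∣ + 1 + -[1+ j ] * + 2 ∣ % 2    ≡⟨ cong (λ t → ∣ t ∣ % 2) (negate (+ j)) ⟩
  ∣ - (+ 1 + + j * + 2) ∣ % 2     ≡⟨ cong (_% 2) (∣-i∣≡∣i∣ (+ 1 + + j * + 2)) ⟩
  ∣ + 1 + + j * + 2 ∣ % 2         ≡⟨ ∣1+k*2∣%2≡1 (+ j) ⟩
  1                               ∎
  where
  open ≡-Reasoning
  negate : ∀ y → + 1 + (- (+ 1 + y)) * + 2 ≡ - (+ 1 + y * + 2)
  negate = ℤ-Ring.solve-∀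

x≡1-mod-2⇒∣x∣%2≡1 : ∀ {x} → x ≡ + 1 [mod + 2 ] → ∣ x ∣ % 2 ≡ 1
x≡1-mod-2⇒∣x∣%2≡1 {x} (divides-difference (divides k x-1≡k*2)) =
  subst (λ y → ∣ y ∣ % 2 ≡ 1) (sym x≡1+k*2) (∣1+k*2∣%2≡1 k)
  where
  x≡1+k*2 : x ≡ + 1 + k * + 2
  x≡1+k*2 = trans (add-sub x) (cong (_+_ (+ 1)) x-1≡k*2)
    where add-sub : ∀ x → x ≡ + 1 + (x - + 1)
          add-sub = ℤ-Ring.solve-∀

corollary13 : (B : ℕ) → 3 ≤ B → B % 2 ≡ 1 → (a b : ℤ) →
    GaussianHappy B (a , b) → ∣ a + b ∣ % 2 ≡ 1
corollary13 B 3≤B B%2≡1 a b (k , _ , Sᵏ[a+bi]≡1) =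
  x≡1-mod-2⇒∣x∣%2≡1 (mod-sym (subst (λ z → reIm z ≡ a + b [mod + 2 ]) Sᵏ[a+bi]≡1 reIm-invariant))
  where
  reIm-invariant : reIm (iter (S B) k (a , b)) ≡ a + b [mod + 2 ]
  reIm-invariant =
    iter-invariant-mod (S B) reIm (reIm-S-mod-2 B (ℕ.<⇒≤ 3≤B) (odd⇒≡1-mod-2 B B%2≡1)) k (a , b)
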